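{- Let $G$ be an external flow network and let $P$, $Q$, $R$ be a partition of its set of terminals into three subsets. Then $(P\not\rightarrow Q\cup R)\le (P\cup Q\not\rightarrow R)+(P\cup R\not\rightarrow Q)$ and $(P\cup Q\not\rightarrow R)\le (P\not\rightarrow Q\cup R)+(Q\not\rightarrow P\cup R)$.
   Context: An external flow network is a directed graph $G=(V,E)$ with nonnegative real capacities $c_e$ on its edges and an ordered set of terminal vertices $q_1,\dots,q_k$. For disjoint sets $S,T$ of terminals, $S\not\rightarrow T$ denotes the minimum, over all vertex sets $A\subseteq V$ with $S\subseteq A$ and $T\cap A=\emptyset$, of the total capacity of edges directed from $A$ to $V\setminus A$ (the minimum capacity of a cut with $S$ on the source side and $T$ on the sink side). -}

module Defs where

open import Level using (0ℓ)
open import Algebra.Bundles using (CommutativeMonoid)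
open import Relation.Binary.Core using (Rel)
open import Relation.Binary.Structures using (IsPreorder)
open import Relation.Binary.PropositionalEquality using (_≡_)
open import Data.Nat using (ℕ)
open import Data.Fin using (Fin)
open import Data.Bool using (Bool; true; false; _∧_; not; if_then_else_)
open import Data.List using (List; foldr)
open import Data.List.Relation.Unary.All using (All)
open import Data.Product using (_×_; _,_; Σ-syntax; proj₁; proj₂)
open import Function.Definitions using (Injective)
import Data.Sum
import Data.Bool

-- The nonnegative reals are an instance; we work
-- abstractly since agda-stdlib has no real numbers.
record OrderedCommMonoid : Set₁ where
  field
    commutativeMonoid : CommutativeMonoid 0ℓ 0ℓ
  open CommutativeMonoid commutativeMonoid public
  infix 4 _≤_
  field
    _≤_        : Rel Carrier 0ℓ
    isPreorder : IsPreorder _≈_ _≤_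
    ∙-mono-≤   : ∀ {a b c d} → a ≤ b → c ≤ d → (a ∙ c) ≤ (b ∙ d)

-- Edges form a list (parallel edges
-- allowed), each edge = (tail , head , capacity), capacities nonnegative.
record ExtFlowNetwork (M : OrderedCommMonoid) (n k : ℕ) : Set where
  open OrderedCommMonoid M
  field
    edges        : List (Fin n × Fin n × Carrier)
    nonneg       : All (λ e → ε ≤ proj₂ (proj₂ e)) edges
    terminal     : Fin k → Fin n
    terminal-inj : Injective _≡_ _≡_ terminal

module _ {M : OrderedCommMonoid} {n k : ℕ} (G : ExtFlowNetwork M n k) where
  open OrderedCommMonoid M
  open ExtFlowNetwork G

  VSet : Set
  VSet = Fin n → Bool

  TSet : Set
  TSet = Fin k → Bool

  cutCap : VSet → Carrier
  cutCap A = foldr (λ e acc → if A (proj₁ e) ∧ not (A (proj₁ (proj₂ e)))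
                               then proj₂ (proj₂ e) ∙ acc else acc) ε edges

  Separates : TSet → TSet → VSet → Set
  Separates S T A =
    (∀ i → S i ≡ true → A (terminal i) ≡ true) ×
    (∀ i → T i ≡ true → A (terminal i) ≡ false)

  -- v is the value S ↛ T: the minimum of cutCap A over separating A
  IsMinCut : TSet → TSet → Carrier → Set
  IsMinCut S T v =
    (Σ[ A ∈ VSet ] (Separates S T A × cutCap A ≈ v)) ×
    (∀ A → Separates S T A → v ≤ cutCap A)

_∪_ : {k : ℕ} → (Fin k → Bool) → (Fin k → Bool) → Fin k → Bool
(S ∪ T) i = Data.Bool._∨_ (S i) (T i)

IsPartition3 : {k : ℕ} → (Fin k → Bool) → (Fin k → Bool) → (Fin k → Bool) → Set
IsPartition3 P Q R = ∀ i →
  ((P i ≡ true) × (Q i ≡ false) × (R i ≡ false)) Data.Sum.⊎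
  (((P i ≡ false) × (Q i ≡ true) × (R i ≡ false)) Data.Sum.⊎
   ((P i ≡ false) × (Q i ≡ false) × (R i ≡ true)))

module Submission where

-- Let A be a minimum (P ∪ Q | R)-cut and B a minimum (P ∪ R | Q)-cut.
-- Their intersection A ∩ B still contains P and avoids Q ∪ R, so it is a
-- (P | Q ∪ R)-separating set; and every edge leaving A ∩ B leaves A or
-- leaves B, so (capacities being nonnegative) cutCap (A ∩ B) ≤ cutCap A +
-- cutCap B.  Hence P ↛ Q ∪ R ≤ (P ∪ Q ↛ R) + (P ∪ R ↛ Q).  Dually, the union
-- of a minimum (P | Q ∪ R)-cut and a minimum (Q | P ∪ R)-cut separates P ∪ Q
-- from R, and an edge leaving A ∪ B leaves A or B, giving the second bound.

open import Defs
open import Data.Nat using (ℕ)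
open import Data.Fin using (Fin)
open import Data.Bool using (Bool; true; false; _∧_; _∨_; not; if_then_else_)
open import Data.Bool.Properties using (∨-comm)
open import Data.Product using (_×_; _,_; proj₂)
open import Data.Sum using (_⊎_; inj₁; inj₂) renaming (map to ⊎-map)
open import Data.List using (List; []; _∷_; foldr)
open import Data.List.Relation.Unary.All using (All; []; _∷_)
open import Relation.Binary.Bundles using (Preorder)
open import Relation.Binary.PropositionalEquality as ≡ using (_≡_; refl)
import Algebra.Properties.CommutativeSemigroup as CommutativeSemigroupProperties
import Relation.Binary.Reasoning.Preorder as PreorderReasoning

∧-true : ∀ {x y} → x ≡ true → y ≡ true → (x ∧ y) ≡ true
∧-true refl refl = refl

∧-false : ∀ {x y} → x ≡ false ⊎ y ≡ false → (x ∧ y) ≡ false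
∧-false {true}  (inj₁ ())
∧-false {true}  (inj₂ y≡f) = y≡f
∧-false {false} _          = refl

∨-true : ∀ {x y} → x ≡ true ⊎ y ≡ true → (x ∨ y) ≡ true
∨-true {true}  _          = refl
∨-true {false} (inj₁ ())
∨-true {false} (inj₂ y≡t) = y≡t

∨-false : ∀ {x y} → x ≡ false → y ≡ false → (x ∨ y) ≡ false
∨-false refl refl = refl

∨-split : ∀ {x y} → (x ∨ y) ≡ true → x ≡ true ⊎ y ≡ true
∨-split {true}  _ = inj₁ refl
∨-split {false} h = inj₂ h

_∩_ : {X : Set} → (X → Bool) → (X → Bool) → X → Bool
(S ∩ T) i = S i ∧ T i

_⊆_ : {X : Set} → (X → Bool) → (X → Bool) → Set
S ⊆ T = ∀ i → S i ≡ true → T i ≡ true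

⊆-refl : {X : Set} {S : X → Bool} → S ⊆ S
⊆-refl _ h = h

∪-upperˡ : {k : ℕ} {S T : Fin k → Bool} → S ⊆ (S ∪ T)
∪-upperˡ _ h = ∨-true (inj₁ h)

∪-upperʳ : {k : ℕ} {S T : Fin k → Bool} → T ⊆ (S ∪ T)
∪-upperʳ _ h = ∨-true (inj₂ h)

∪-swap : {k : ℕ} {S T : Fin k → Bool} → (S ∪ T) ⊆ (T ∪ S)
∪-swap {S = S} {T} i h = ≡.trans (∨-comm (T i) (S i)) h

leaves : Bool → Bool → Bool
leaves tail∈X head∈X = tail∈X ∧ not head∈X

leaves-∧ : ∀ a b a′ b′ → leaves (a ∧ b) (a′ ∧ b′) ≡ true →
           leaves a a′ ≡ true ⊎ leaves b b′ ≡ true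
leaves-∧ true  true  false _     _  = inj₁ refl
leaves-∧ true  true  true  false _  = inj₂ refl
leaves-∧ true  true  true  true  ()
leaves-∧ true  false _     _     ()
leaves-∧ false _     _     _     ()

leaves-∨ : ∀ a b a′ b′ → leaves (a ∨ b) (a′ ∨ b′) ≡ true →
           leaves a a′ ≡ true ⊎ leaves b b′ ≡ true
leaves-∨ true  _     false false _  = inj₁ refl
leaves-∨ true  _     false true  ()
leaves-∨ true  _     true  _     ()
leaves-∨ false true  false false _  = inj₂ refl
leaves-∨ false true  false true  ()
leaves-∨ false true  true  _     ()
leaves-∨ false false _     _     ()

module WeightedSums (M : OrderedCommMonoid) where
  open OrderedCommMonoid M
  open CommutativeSemigroupProperties commutativeSemigroup using (x∙yz≈y∙xz)

  ≤-preorder : Preorder _ _ _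
  ≤-preorder = record { isPreorder = isPreorder }

  open Preorder ≤-preorder using () renaming (reflexive to ≤-reflexive; refl to ≤-refl)
  open PreorderReasoning ≤-preorder

  sumWhere : {X : Set} → (X → Carrier) → (X → Bool) → List X → Carrier
  sumWhere w r = foldr (λ x acc → if r x then w x ∙ acc else acc) ε

  ≤-∙ˡ : ∀ {w x} → ε ≤ w → x ≤ w ∙ x
  ≤-∙ˡ {w} {x} ε≤w = begin
    x      ≈⟨ sym (identityˡ x) ⟩
    ε ∙ x  ≲⟨ ∙-mono-≤ ε≤w ≤-refl ⟩
    w ∙ x  ∎

  sumWhere-cons : {X : Set} (w : X → Carrier) (r : X → Bool) (x : X) (xs : List X) →
                  ε ≤ w x → sumWhere w r xs ≤ sumWhere w r (x ∷ xs)
  sumWhere-cons w r x xs ε≤wx with r x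
  ... | true  = ≤-∙ˡ ε≤wx
  ... | false = ≤-refl

  sumWhere-subadditive :
    {X : Set} (w : X → Carrier) (r p q : X → Bool) →
    (∀ x → r x ≡ true → p x ≡ true ⊎ q x ≡ true) →
    (xs : List X) → All (λ x → ε ≤ w x) xs →
    sumWhere w r xs ≤ sumWhere w p xs ∙ sumWhere w q xs
  sumWhere-subadditive w r p q covered [] [] = ≤-reflexive (sym (identityˡ ε))
  sumWhere-subadditive w r p q covered (x ∷ xs) (ε≤wx ∷ nonneg) with r x in rx
  ... | false = begin
    R        ≲⟨ IH ⟩
    P ∙ Q    ≲⟨ ∙-mono-≤ (sumWhere-cons w p x xs ε≤wx) (sumWhere-cons w q x xs ε≤wx) ⟩
    P′ ∙ Q′  ∎
    where
    R = sumWhere w r xs; P = sumWhere w p xs; Q = sumWhere w q xs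
    P′ = sumWhere w p (x ∷ xs); Q′ = sumWhere w q (x ∷ xs)
    IH = sumWhere-subadditive w r p q covered xs nonneg
  ... | true with covered x rx
  ...   | inj₁ px rewrite px = begin
    w x ∙ R          ≲⟨ ∙-mono-≤ ≤-refl IH ⟩
    w x ∙ (P ∙ Q)    ≲⟨ ∙-mono-≤ ≤-refl (∙-mono-≤ ≤-refl (sumWhere-cons w q x xs ε≤wx)) ⟩
    w x ∙ (P ∙ Q′)   ≈⟨ sym (assoc _ _ _) ⟩
    (w x ∙ P) ∙ Q′   ∎
    where
    R = sumWhere w r xs; P = sumWhere w p xs; Q = sumWhere w q xs
    Q′ = sumWhere w q (x ∷ xs)
    IH = sumWhere-subadditive w r p q covered xs nonneg
  ...   | inj₂ qx rewrite qx = begin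
    w x ∙ R          ≲⟨ ∙-mono-≤ ≤-refl IH ⟩
    w x ∙ (P ∙ Q)    ≲⟨ ∙-mono-≤ ≤-refl (∙-mono-≤ (sumWhere-cons w p x xs ε≤wx) ≤-refl) ⟩
    w x ∙ (P′ ∙ Q)   ≈⟨ x∙yz≈y∙xz _ _ _ ⟩
    P′ ∙ (w x ∙ Q)   ∎
    where
    R = sumWhere w r xs; P = sumWhere w p xs; Q = sumWhere w q xs
    P′ = sumWhere w p (x ∷ xs)
    IH = sumWhere-subadditive w r p q covered xs nonneg

module Cuts {M : OrderedCommMonoid} {n k : ℕ} (G : ExtFlowNetwork M n k) where
  open OrderedCommMonoid M
  open ExtFlowNetwork G
  open WeightedSums M

  Edge : Set
  Edge = Fin n × Fin n × Carrier

  leavesSet : VSet G → Edge → Bool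
  leavesSet A (u , v , _) = leaves (A u) (A v)

  cutCap-subadditive : (X A B : VSet G) →
    (∀ e → leavesSet X e ≡ true → leavesSet A e ≡ true ⊎ leavesSet B e ≡ true) →
    cutCap G X ≤ cutCap G A ∙ cutCap G B
  cutCap-subadditive X A B covered =
    sumWhere-subadditive (λ e → proj₂ (proj₂ e))
      (leavesSet X) (leavesSet A) (leavesSet B) covered edges nonneg

  cutCap-∩ : (A B : VSet G) → cutCap G (A ∩ B) ≤ cutCap G A ∙ cutCap G B
  cutCap-∩ A B = cutCap-subadditive (A ∩ B) A B
    (λ (u , v , _) → leaves-∧ (A u) (B u) (A v) (B v))

  cutCap-∪ : (A B : VSet G) → cutCap G (A ∪ B) ≤ cutCap G A ∙ cutCap G B
  cutCap-∪ A B = cutCap-subadditive (A ∪ B) A B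
    (λ (u , v , _) → leaves-∨ (A u) (B u) (A v) (B v))

  separates-∩ : ∀ {S₁ T₁ S₂ T₂ S T} (A B : VSet G) →
    Separates G S₁ T₁ A → Separates G S₂ T₂ B →
    S ⊆ S₁ → S ⊆ S₂ → T ⊆ (T₁ ∪ T₂) → Separates G S T (A ∩ B)
  separates-∩ A B (A⊇S₁ , A∌T₁) (B⊇S₂ , B∌T₂) S⊆S₁ S⊆S₂ T⊆T₁∪T₂ =
      (λ i Si → ∧-true (A⊇S₁ i (S⊆S₁ i Si)) (B⊇S₂ i (S⊆S₂ i Si)))
    , (λ i Ti → ∧-false (⊎-map (A∌T₁ i) (B∌T₂ i) (∨-split (T⊆T₁∪T₂ i Ti))))

  separates-∪ : ∀ {S₁ T₁ S₂ T₂ S T} (A B : VSet G) →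
    Separates G S₁ T₁ A → Separates G S₂ T₂ B →
    S ⊆ (S₁ ∪ S₂) → T ⊆ T₁ → T ⊆ T₂ → Separates G S T (A ∪ B)
  separates-∪ A B (A⊇S₁ , A∌T₁) (B⊇S₂ , B∌T₂) S⊆S₁∪S₂ T⊆T₁ T⊆T₂ =
      (λ i Si → ∨-true (⊎-map (A⊇S₁ i) (B⊇S₂ i) (∨-split (S⊆S₁∪S₂ i Si))))
    , (λ i Ti → ∨-false (A∌T₁ i (T⊆T₁ i Ti)) (B∌T₂ i (T⊆T₂ i Ti)))


  open PreorderReasoning ≤-preorder
  open Preorder ≤-preorder using () renaming (reflexive to ≤-reflexive)

  minCut-combine : ∀ {S T S₁ T₁ S₂ T₂ v v₁ v₂} (_⊗_ : VSet G → VSet G → VSet G) →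
    (∀ A B → Separates G S₁ T₁ A → Separates G S₂ T₂ B → Separates G S T (A ⊗ B)) →
    (∀ A B → cutCap G (A ⊗ B) ≤ cutCap G A ∙ cutCap G B) →
    IsMinCut G S T v → IsMinCut G S₁ T₁ v₁ → IsMinCut G S₂ T₂ v₂ →
    v ≤ v₁ ∙ v₂
  minCut-combine {v = v} {v₁} {v₂} _⊗_ separates subadditive
    (_ , v-minimal) ((A , A-sep , A-cap) , _) ((B , B-sep , B-cap) , _) = begin
      v                      ≲⟨ v-minimal (A ⊗ B) (separates A B A-sep B-sep) ⟩
      cutCap G (A ⊗ B)       ≲⟨ subadditive A B ⟩
      cutCap G A ∙ cutCap G B  ≲⟨ ∙-mono-≤ (≤-reflexive A-cap) (≤-reflexive B-cap) ⟩
      v₁ ∙ v₂                ∎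

lemma3 : (M : OrderedCommMonoid) {n k : ℕ} (G : ExtFlowNetwork M n k)
    (P Q R : Fin k → Bool) → IsPartition3 P Q R →
    (a b c d : OrderedCommMonoid.Carrier M) →
    IsMinCut G P (Q ∪ R) a → IsMinCut G (P ∪ Q) R b →
    IsMinCut G (P ∪ R) Q c → IsMinCut G Q (P ∪ R) d →
    OrderedCommMonoid._≤_ M a (OrderedCommMonoid._∙_ M b c)
      × OrderedCommMonoid._≤_ M b (OrderedCommMonoid._∙_ M a d)
lemma3 M G P Q R _ a b c d a-min b-min c-min d-min =
    minCut-combine _∩_
      (λ B C B-sep C-sep → separates-∩ B C B-sep C-sep ∪-upperˡ ∪-upperˡ (∪-swap {S = Q} {T = R}))
      cutCap-∩ a-min b-min c-min
  , minCut-combine _∪_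
      (λ A D A-sep D-sep → separates-∪ A D A-sep D-sep ⊆-refl ∪-upperʳ ∪-upperʳ)
      cutCap-∪ b-min a-min d-min
  where open Cuts G
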